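{- $BR_5(K_{2,2},K_{4,4})=26$.
   Context: For bipartite graphs $H_1,H_2$ and a positive integer $m$, $BR_m(H_1,H_2)$ is the least positive integer $n$ such that for every subgraph $G$ of $K_{m,n}$ (parts of sizes $m$ and $n$), either $G$ contains a copy of $H_1$ or the bipartite complement $\overline{G}=K_{m,n}-E(G)$ contains a copy of $H_2$. -}

module Defs where

open import Data.Nat using (ℕ; _≤_; _<_)
open import Data.Fin using (Fin)
open import Data.Bool using (Bool; T; not)
open import Data.Product using (Σ; _×_)
open import Data.Sum using (_⊎_)
open import Relation.Nullary using (¬_)
open import Relation.Binary.PropositionalEquality using (_≡_)
open import Function.Definitions using (Injective)

-- A subgraph of K_{m,n}: parts Fin m and Fin n, edge relation given by a Boolean matrix.
BipGraph : ℕ → ℕ → Set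
BipGraph m n = Fin m → Fin n → Bool

bcomp : ∀ {m n} → BipGraph m n → BipGraph m n
bcomp G i j = not (G i j)

ContainsK : ∀ {m n} → ℕ → ℕ → BipGraph m n → Set
ContainsK {m} {n} s t G =
  Σ (Fin s → Fin m) λ f → Σ (Fin t → Fin n) λ g →
    Injective _≡_ _≡_ f × Injective _≡_ _≡_ g × (∀ i j → T (G (f i) (g j)))

-- A subgraph copy of K_{s,t} in a bipartite host may use either orientation.
ContainsBip : ∀ {m n} → ℕ → ℕ → BipGraph m n → Set
ContainsBip s t G = ContainsK s t G ⊎ ContainsK t s G

RamseyProp : ℕ → ℕ → ℕ → ℕ → ℕ → ℕ → Set
RamseyProp a b c d m n =
  (G : BipGraph m n) → ContainsBip a b G ⊎ ContainsBip c d (bcomp G)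

IsBR : ℕ → ℕ → ℕ → ℕ → ℕ → ℕ → Set
IsBR m a b c d r =
  1 ≤ r × RamseyProp a b c d m r × (∀ n → 1 ≤ n → n < r → ¬ RamseyProp a b c d m n)

-- View G ⊆ K_{2+s,n} as a (2+s) × n Boolean matrix and sort its columns into boxes: a
-- column with two neighbours i < j goes into the pair box (i, j), any other column into a
-- single box r such that the column has no neighbour except possibly r.  Two columns in
-- the same pair box span a K_{2,2} in G; 1 + s columns in the single box r span, together
-- with the 1 + s rows other than r, a K_{1+s,1+s} in the complement.  So each pair box can
-- hold one column and each single box s columns, and once n exceeds the total capacity
-- C(2+s,2) + (2+s)s some box overflows.  Conversely, the graph whose columns fill every box
-- exactly to capacity, each column adjacent to the rows of its box, has neither
-- configuration.  For s = 3 the capacity is 10 + 15 = 25.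

module Submission where

open import Defs
open import Data.Nat as ℕ using (ℕ; zero; suc; _+_; _*_; _≤_; z≤n; s≤s)
import Data.Nat.Properties as ℕ
open import Algebra.Properties.CommutativeMonoid.Sum ℕ.+-0-commutativeMonoid
  using (sum; sum-remove; sum-cong-≗)
open import Data.Bool using (Bool; false; T; not; if_then_else_)
open import Data.Empty using (⊥-elim)
open import Data.Fin
  using (Fin; zero; suc; _<_; inject≤; punchIn; splitAt; join; _↑ˡ_; _↑ʳ_; remQuot; combine)
open import Data.Fin.Properties
  using (_≟_; _<?_; <-cmp; <-irrefl; <-asym; <⇒≢; any?; toℕ<n; suc-injective; injective⇒≤;
         inject≤-injective; punchIn-injective; punchInᵢ≢i; splitAt-↑ˡ; splitAt-↑ʳ;
         splitAt⁻¹-↑ˡ; splitAt⁻¹-↑ʳ; remQuot-combine; combine-remQuot)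
open import Data.Product using (Σ; ∃-syntax; _×_; _,_; proj₁; proj₂; uncurry)
open import Data.Sum as Sum using (_⊎_; inj₁; inj₂; [_,_]′)
open import Data.Vec.Functional using (Vector; []; _∷_; tail; updateAt; removeAt)
open import Data.Vec.Functional.Properties using (updateAt-updates; updateAt-minimal)
open import Function using (_∘_; Injective)
open import Relation.Binary using (tri<; tri≈; tri>)
open import Relation.Binary.PropositionalEquality
  using (_≡_; _≢_; refl; sym; trans; cong; cong₂; subst; module ≡-Reasoning)
open import Relation.Nullary using (¬_; Dec; yes; no)
open import Relation.Nullary.Decidable
  using (⌊_⌋; toWitness; toWitnessFalse; dec-false; T?; _×-dec_; _⊎-dec_)

private
  variable
    A : Set
    k m n n′ t : ℕ

cons-injective : {x : A} {f : Vector A n} → Injective _≡_ _≡_ f → (∀ i → f i ≢ x) →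
                 Injective _≡_ _≡_ (x ∷ f)
cons-injective _     _   {zero}  {zero}  _     = refl
cons-injective _     x∉f {zero}  {suc j} x≡fj  = ⊥-elim (x∉f j (sym x≡fj))
cons-injective _     x∉f {suc i} {zero}  fi≡x  = ⊥-elim (x∉f i fi≡x)
cons-injective f-inj _   {suc i} {suc j} fi≡fj = cong suc (f-inj fi≡fj)

outside-image-unique : {f : Fin t → Fin (suc t)} → Injective _≡_ _≡_ f →
                       ∀ {a b} → (∀ i → f i ≢ a) → (∀ i → f i ≢ b) → a ≡ b
outside-image-unique {f = f} f-inj {a} {b} a∉f b∉f with a ≟ b
... | yes a≡b = a≡b
... | no  a≢b =
  ⊥-elim (ℕ.<-irrefl refl (injective⇒≤ (cons-injective (cons-injective f-inj b∉f) a∉b∷f)))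
  where
  a∉b∷f : ∀ i → (b ∷ f) i ≢ a
  a∉b∷f zero    = a≢b ∘ sym
  a∉b∷f (suc i) = a∉f i

sum-updateAt-pred : (c : Vector ℕ k) (b : Fin k) {c₀ : ℕ} → c b ≡ suc c₀ →
                    sum c ≡ suc (sum (updateAt c b ℕ.pred))
sum-updateAt-pred {suc k} c b {c₀} cb≡1+c₀ = begin
  sum c                          ≡⟨ sum-remove c ⟩
  c b + sum (removeAt c b)       ≡⟨ cong₂ _+_ cb≡1+c₀ (sum-cong-≗ unchanged) ⟩
  suc (c₀ + sum (removeAt c′ b)) ≡⟨ cong (λ x → suc (x + sum (removeAt c′ b))) c′b≡c₀ ⟨
  suc (c′ b + sum (removeAt c′ b)) ≡⟨ cong suc (sum-remove c′) ⟨
  suc (sum c′)                   ∎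
  where
  open ≡-Reasoning
  c′ : Vector ℕ (suc k)
  c′ = updateAt c b ℕ.pred
  unchanged : ∀ j → removeAt c b j ≡ removeAt c′ b j
  unchanged j = sym (updateAt-minimal _ b c (punchInᵢ≢i b j))
  c′b≡c₀ : c′ b ≡ c₀
  c′b≡c₀ = trans (updateAt-updates b c) (cong ℕ.pred cb≡1+c₀)

pigeonhole-weighted : (c : Vector ℕ k) (f : Fin n → Fin k) → sum c ℕ.< n →
  ∃[ b ] ∃[ m ] Σ (Fin m → Fin n) λ h → Injective _≡_ _≡_ h × c b ℕ.< m × (∀ i → f (h i) ≡ b)
-- Pigeon 0 takes up one place in its box f 0; the remaining pigeons see one place less there.
pigeonhole-weighted {n = suc n} c f ∑c<1+n with c (f zero) in cb₀≡
... | zero = f zero , 1 , (λ _ → zero) , (λ { {zero} {zero} _ → refl }) ,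
             subst (ℕ._< 1) (sym cb₀≡) (s≤s z≤n) , λ { zero → refl }
... | suc c₀
  with b , m , h , h-inj , c′b<m , fh≡b ←
         pigeonhole-weighted (updateAt c (f zero) ℕ.pred) (f ∘ suc)
           (ℕ.≤-pred (subst (ℕ._< suc n) (sum-updateAt-pred c (f zero) cb₀≡) ∑c<1+n))
  with b ≟ f zero
... | yes refl =
  b , suc m , zero ∷ suc ∘ h , cons-injective (h-inj ∘ suc-injective) (λ _ ()) ,
  subst (ℕ._< suc m) (sym cb₀≡)
    (s≤s (subst (ℕ._< m) (trans (updateAt-updates b c) (cong ℕ.pred cb₀≡)) c′b<m)) ,
  λ { zero → refl ; (suc i) → fh≡b i }
... | no b≢f₀ =
  b , m , suc ∘ h , h-inj ∘ suc-injective ,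
  subst (ℕ._< m) (updateAt-minimal b (f zero) c b≢f₀) c′b<m , fh≡b

unpack : (c : Vector ℕ k) → Fin (sum c) → Σ (Fin k) (Fin ∘ c)
unpack {suc k} c x with splitAt (c zero) x
... | inj₁ i = zero , i
... | inj₂ y = let (b , i) = unpack (tail c) y in suc b , i

pack : (c : Vector ℕ k) → Σ (Fin k) (Fin ∘ c) → Fin (sum c)
pack {suc k} c (zero  , i) = i ↑ˡ sum (tail c)
pack {suc k} c (suc b , i) = c zero ↑ʳ pack (tail c) (b , i)

pack-unpack : (c : Vector ℕ k) (x : Fin (sum c)) → pack c (unpack c x) ≡ x
pack-unpack {suc k} c x with splitAt (c zero) x in eq
... | inj₁ i = splitAt⁻¹-↑ˡ eq
... | inj₂ y = trans (cong (c zero ↑ʳ_) (pack-unpack (tail c) y)) (splitAt⁻¹-↑ʳ eq)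

unpack-injective : (c : Vector ℕ k) → Injective _≡_ _≡_ (unpack c)
unpack-injective c {x} {y} eq =
  trans (sym (pack-unpack c x)) (trans (cong (pack c) eq) (pack-unpack c y))

fibre-bound : (c : Vector ℕ k) {b : Fin k} (g : Fin t → Fin (sum c)) → Injective _≡_ _≡_ g →
              (∀ l → proj₁ (unpack c (g l)) ≡ b) → t ≤ c b
fibre-bound c {b} g g-inj in-b =
  injective⇒≤ {f = λ l → subst (Fin ∘ c) (in-b l) (proj₂ (unpack c (g l)))}
    (λ {l} {l′} eq → g-inj (unpack-injective c (same-slot _ _ (in-b l) (in-b l′) eq)))
  where
  same-slot : ∀ u v (p : proj₁ u ≡ b) (q : proj₁ v ≡ b) →
              subst (Fin ∘ c) p (proj₂ u) ≡ subst (Fin ∘ c) q (proj₂ v) → u ≡ v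
  same-slot _ _ refl refl refl = refl

ContainsK-restrict : (n≤n′ : n ≤ n′) (G : BipGraph m n′) {s t : ℕ} →
                     ContainsK s t (λ i j → G i (inject≤ j n≤n′)) → ContainsK s t G
ContainsK-restrict n≤n′ _ (f , g , f-inj , g-inj , edges) =
  f , (λ j → inject≤ (g j) n≤n′) , f-inj , g-inj ∘ inject≤-injective n≤n′ n≤n′ _ _ , edges

RamseyProp-mono : ∀ {a b c d} → n ≤ n′ → RamseyProp a b c d m n → RamseyProp a b c d m n′
RamseyProp-mono n≤n′ R G =
  Sum.map (Sum.map (ContainsK-restrict n≤n′ G) (ContainsK-restrict n≤n′ G))
          (Sum.map (ContainsK-restrict n≤n′ (bcomp G)) (ContainsK-restrict n≤n′ (bcomp G)))
          (R (λ i j → G i (inject≤ j n≤n′)))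

common-pair⇒K22 : {G : BipGraph m n} {i j : Fin m} → i ≢ j →
                  (h : Fin 2 → Fin n) → Injective _≡_ _≡_ h →
                  (∀ l → T (G i (h l)) × T (G j (h l))) → ContainsK 2 2 G
common-pair⇒K22 {G = G} {i} {j} i≢j h h-inj adj =
  (i ∷ j ∷ []) , h , ij-injective , h-inj , edges
  where
  ij-injective : Injective _≡_ _≡_ (i ∷ j ∷ [])
  ij-injective =
    cons-injective (cons-injective (λ { {()} }) (λ ())) (λ { zero → i≢j ∘ sym ; (suc ()) })
  edges : ∀ a l → T (G ((i ∷ j ∷ []) a) (h l))
  edges zero       l = proj₁ (adj l)
  edges (suc zero) l = proj₂ (adj l)

avoid-row⇒bcomp-K : {G : BipGraph (suc t) n} (r : Fin (suc t)) (h : Fin t → Fin n) →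
                    Injective _≡_ _≡_ h → (∀ l i → i ≢ r → G i (h l) ≡ false) →
                    ContainsK t t (bcomp G)
avoid-row⇒bcomp-K r h h-inj off-r =
  punchIn r , h , punchIn-injective r _ _ , h-inj ,
  λ i l → subst (T ∘ not) (sym (off-r l (punchIn r i) (punchInᵢ≢i r i))) _

Box : ℕ → Set
Box m = (Fin m × Fin m) ⊎ Fin m

_∈ᴮ_ : Fin m → Box m → Set
a ∈ᴮ inj₁ (i , j) = a ≡ i ⊎ a ≡ j
a ∈ᴮ inj₂ r       = a ≡ r

_∈ᴮ?_ : (a : Fin m) (B : Box m) → Dec (a ∈ᴮ B)
a ∈ᴮ? inj₁ (i , j) = a ≟ i ⊎-dec a ≟ j
a ∈ᴮ? inj₂ r       = a ≟ r

Classifies : Box m → (Fin m → Bool) → Set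
Classifies (inj₁ (i , j)) c = i < j × T (c i) × T (c j)
Classifies (inj₂ r)       c = ∀ i → i ≢ r → c i ≡ false

classify : (c : Fin (suc m) → Bool) → ∃[ B ] Classifies B c
classify c with any? (λ i → any? λ j → i <? j ×-dec T? (c i) ×-dec T? (c j))
... | yes (i , j , i<j , ci , cj) = inj₁ (i , j) , i<j , ci , cj
... | no no-pair with any? (T? ∘ c)
...   | no no-edge   = inj₂ zero , λ i _ → dec-false (T? (c i)) λ ci → no-edge (i , ci)
...   | yes (r , cr) = inj₂ r , λ i i≢r → dec-false (T? (c i)) (no-pair ∘ pair-with-r i i≢r)
  where
  pair-with-r : ∀ i → i ≢ r → T (c i) → ∃[ i ] ∃[ j ] i < j × T (c i) × T (c j)
  pair-with-r i i≢r ci with <-cmp i r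
  ... | tri< i<r _ _ = i , r , i<r , ci , cr
  ... | tri≈ _ i≡r _ = ⊥-elim (i≢r i≡r)
  ... | tri> _ _ r<i = r , i , r<i , cr , ci

column : BipGraph m n → Fin n → Fin m → Bool
column G x i = G i x

box-of : BipGraph (suc m) n → Fin n → Box (suc m)
box-of G = proj₁ ∘ classify ∘ column G

box-of-classifies : (G : BipGraph (suc m) n) (x : Fin n) → Classifies (box-of G x) (column G x)
box-of-classifies G = proj₂ ∘ classify ∘ column G

pair-members : {i j a b : Fin m} → a ≢ b → a ∈ᴮ inj₁ (i , j) → b ∈ᴮ inj₁ (i , j) →
               (i , j) ≡ (a , b) ⊎ (i , j) ≡ (b , a)
pair-members a≢b (inj₁ refl) (inj₁ refl) = ⊥-elim (a≢b refl)
pair-members _   (inj₁ refl) (inj₂ refl) = inj₁ refl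
pair-members _   (inj₂ refl) (inj₁ refl) = inj₂ refl
pair-members a≢b (inj₂ refl) (inj₂ refl) = ⊥-elim (a≢b refl)

ordered-pair-unique : {i j i′ j′ a b : Fin m} → i < j → i′ < j′ → a ≢ b →
                      a ∈ᴮ inj₁ (i , j) → b ∈ᴮ inj₁ (i , j) →
                      a ∈ᴮ inj₁ (i′ , j′) → b ∈ᴮ inj₁ (i′ , j′) → (i , j) ≡ (i′ , j′)
ordered-pair-unique i<j i′<j′ a≢b a∈ b∈ a∈′ b∈′
  with pair-members a≢b a∈ b∈ | pair-members a≢b a∈′ b∈′
... | inj₁ refl | inj₁ refl = refl
... | inj₁ refl | inj₂ refl = ⊥-elim (<-asym i<j i′<j′)
... | inj₂ refl | inj₁ refl = ⊥-elim (<-asym i<j i′<j′)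
... | inj₂ refl | inj₂ refl = refl

toBox : Fin (m * m + m) → Box m
toBox {m} = Sum.map₁ (remQuot m) ∘ splitAt (m * m)

fromBox : Box m → Fin (m * m + m)
fromBox {m} = join (m * m) m ∘ Sum.map₁ (uncurry combine)

toBox-fromBox : (B : Box m) → toBox {m} (fromBox B) ≡ B
toBox-fromBox {m} (inj₁ (i , j)) rewrite splitAt-↑ˡ (m * m) (combine i j) m =
  cong inj₁ (remQuot-combine i j)
toBox-fromBox {m} (inj₂ r) rewrite splitAt-↑ʳ (m * m) m r = refl

fromBox-toBox : (x : Fin (m * m + m)) → fromBox (toBox {m} x) ≡ x
fromBox-toBox {m} x with splitAt (m * m) x in eq
... | inj₁ y = trans (cong (_↑ˡ m) (combine-remQuot {m} m y)) (splitAt⁻¹-↑ˡ eq)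
... | inj₂ r = splitAt⁻¹-↑ʳ eq

module _ (s : ℕ) where

  -- Only pair boxes (i, j) with i < j are used, so the others get capacity 0.
  capacity : Box (2 + s) → ℕ
  capacity (inj₁ (i , j)) = if ⌊ i <? j ⌋ then 1 else 0
  capacity (inj₂ _)       = s

  capacityᶠ : Vector ℕ ((2 + s) * (2 + s) + (2 + s))
  capacityᶠ = capacity ∘ toBox

  capacity-ordered-pair : {i j : Fin (2 + s)} → i < j → capacity (inj₁ (i , j)) ≡ 1
  capacity-ordered-pair {i} {j} i<j with i <? j
  ... | yes _   = refl
  ... | no  i≮j = ⊥-elim (i≮j i<j)

  capacity-pair≤1 : {i j : Fin (2 + s)} → capacity (inj₁ (i , j)) ≤ 1
  capacity-pair≤1 {i} {j} with i <? j
  ... | yes _ = ℕ.≤-refl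
  ... | no  _ = z≤n

  capacity-pair-positive : {i j : Fin (2 + s)} → 0 ℕ.< capacity (inj₁ (i , j)) → i < j
  capacity-pair-positive {i} {j} _ with i <? j
  ... | yes i<j = i<j

  overflow : (G : BipGraph (2 + s) n) (B : Box (2 + s)) (h : Fin (suc (capacity B)) → Fin n) →
             Injective _≡_ _≡_ h → (∀ l → Classifies B (column G (h l))) →
             ContainsBip 2 2 G ⊎ ContainsBip (suc s) (suc s) (bcomp G)
  overflow G (inj₁ (i , j)) h h-inj cls =
    inj₁ (inj₁ (common-pair⇒K22 {G = G} (<⇒≢ i<j) (λ l → h (inject≤ l 2≤1+cap))
                  (inject≤-injective 2≤1+cap 2≤1+cap _ _ ∘ h-inj)
                  (λ l → proj₂ (cls (inject≤ l 2≤1+cap)))))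
    where
    i<j : i < j
    i<j = proj₁ (cls zero)
    2≤1+cap : 2 ≤ suc (capacity (inj₁ (i , j)))
    2≤1+cap = s≤s (ℕ.≤-reflexive (sym (capacity-ordered-pair i<j)))
  overflow G (inj₂ r) h h-inj cls = inj₂ (inj₁ (avoid-row⇒bcomp-K {G = G} r h h-inj cls))

  upper-bound : ∀ n → sum capacityᶠ ℕ.< n → RamseyProp 2 2 (suc s) (suc s) (2 + s) n
  upper-bound n ∑<n G
    with b , k , h , h-inj , cap<k , in-b ←
           pigeonhole-weighted capacityᶠ (fromBox ∘ box-of G) ∑<n
    = overflow G (toBox b) (λ l → h (inject≤ l cap<k))
        (inject≤-injective cap<k cap<k _ _ ∘ h-inj)
        λ l → subst (λ B → Classifies B (column G (h (inject≤ l cap<k))))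
                    (trans (sym (toBox-fromBox _)) (cong toBox (in-b _)))
                    (box-of-classifies G _)

  column-box : Fin (sum capacityᶠ) → Box (2 + s)
  column-box = toBox ∘ proj₁ ∘ unpack capacityᶠ

  extremal : BipGraph (2 + s) (sum capacityᶠ)
  extremal a x = ⌊ a ∈ᴮ? column-box x ⌋

  column-box-fibre-bound : (g : Fin t → Fin (sum capacityᶠ)) → Injective _≡_ _≡_ g →
                     {B : Box (2 + s)} → (∀ l → column-box (g l) ≡ B) → t ≤ capacity B
  column-box-fibre-bound g g-inj {B} in-B =
    subst (λ B′ → _ ≤ capacity B′) (toBox-fromBox B)
      (fibre-bound capacityᶠ g g-inj λ l →
        trans (sym (fromBox-toBox {2 + s} _)) (cong (fromBox {2 + s}) (in-B l)))

  column-box-ordered : ∀ x {i j} → column-box x ≡ inj₁ (i , j) → i < j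
  column-box-ordered x eq =
    capacity-pair-positive
      (subst (λ B → 0 ℕ.< capacity B) eq (ℕ.≤-<-trans z≤n (toℕ<n (proj₂ (unpack capacityᶠ x)))))

  common-column-box : ∀ {a b} x y → a ≢ b → a ∈ᴮ column-box x → b ∈ᴮ column-box x →
                      a ∈ᴮ column-box y → b ∈ᴮ column-box y → column-box x ≡ column-box y
  common-column-box x y a≢b a∈x b∈x a∈y b∈y with column-box x in ex | column-box y in ey
  ... | inj₂ _ | _      = ⊥-elim (a≢b (trans a∈x (sym b∈x)))
  ... | inj₁ _ | inj₂ _ = ⊥-elim (a≢b (trans a∈y (sym b∈y)))
  ... | inj₁ _ | inj₁ _ =
    cong inj₁ (ordered-pair-unique (column-box-ordered x ex) (column-box-ordered y ey)
                                   a≢b a∈x b∈x a∈y b∈y)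

  two-members⇒capacity≤1 : ∀ {a b} {B : Box (2 + s)} → a ≢ b → a ∈ᴮ B → b ∈ᴮ B →
                           capacity B ≤ 1
  two-members⇒capacity≤1 {B = inj₁ _} _   _   _   = capacity-pair≤1
  two-members⇒capacity≤1 {B = inj₂ _} a≢b a≡r b≡r = ⊥-elim (a≢b (trans a≡r (sym b≡r)))

  avoiding-column-box : {f : Fin (suc s) → Fin (2 + s)} → Injective _≡_ _≡_ f →
                        ∀ x → (∀ k → ¬ f k ∈ᴮ column-box x) →
                        ∃[ r ] column-box x ≡ inj₂ r × (∀ k → f k ≢ r)
  avoiding-column-box f-inj x avoid with column-box x in ex
  ... | inj₁ (i , j) =
    ⊥-elim (<-irrefl (outside-image-unique f-inj (λ k → avoid k ∘ inj₁) (λ k → avoid k ∘ inj₂))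
                     (column-box-ordered x ex))
  ... | inj₂ r = r , refl , avoid

  extremal-K22-free : ¬ ContainsK 2 2 extremal
  extremal-K22-free (f , g , f-inj , g-inj , edges) =
    ℕ.<-irrefl refl (ℕ.≤-trans (column-box-fibre-bound g g-inj same-box)
                               (two-members⇒capacity≤1 f₀≢f₁ (∈ zero zero) (∈ (suc zero) zero)))
    where
    f₀≢f₁ : f zero ≢ f (suc zero)
    f₀≢f₁ = (λ ()) ∘ f-inj
    ∈ : ∀ k l → f k ∈ᴮ column-box (g l)
    ∈ k l = toWitness (edges k l)
    same-box : ∀ l → column-box (g l) ≡ column-box (g zero)
    same-box zero       = refl
    same-box (suc zero) =
      common-column-box (g (suc zero)) (g zero) f₀≢f₁
        (∈ zero (suc zero)) (∈ (suc zero) (suc zero)) (∈ zero zero) (∈ (suc zero) zero)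

  bcomp-extremal-K-free : ¬ ContainsK (suc s) (suc s) (bcomp extremal)
  bcomp-extremal-K-free (f , g , f-inj , g-inj , non-edges) =
    ℕ.<-irrefl refl (column-box-fibre-bound g g-inj same-box)
    where
    single : ∀ l → ∃[ r ] column-box (g l) ≡ inj₂ r × (∀ k → f k ≢ r)
    single l = avoiding-column-box f-inj (g l) λ k → toWitnessFalse (non-edges k l)
    r₀ : Fin (2 + s)
    r₀ = proj₁ (single zero)
    same-box : ∀ l → column-box (g l) ≡ inj₂ r₀
    same-box l with single l | single zero
    ... | r , eq , r∉f | _ , _ , r₀∉f = trans eq (cong inj₂ (outside-image-unique f-inj r∉f r₀∉f))

  lower-bound : ¬ RamseyProp 2 2 (suc s) (suc s) (2 + s) (sum capacityᶠ)
  lower-bound R = [ [ extremal-K22-free , extremal-K22-free ]′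
                  , [ bcomp-extremal-K-free , bcomp-extremal-K-free ]′ ]′ (R extremal)

theorem3 : IsBR 5 2 2 4 4 26
theorem3 =
  s≤s z≤n , upper-bound 3 26 ℕ.≤-refl ,
  λ n _ n<26 → lower-bound 3 ∘ RamseyProp-mono (ℕ.≤-pred n<26)
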